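{- Let $G=(V,E)$ be a graph of order $n\ge 2$ and let $H$ be a graph with at least two vertices and root vertex $v$. Then $$n(i(H)-1)+i(G)\le i(G\circ H)\le i(H)\,\alpha(G)+i(H-v)\,(n-\alpha(G)).$$
   Context: All graphs are finite, simple and undirected. A set $D$ of vertices is an independent dominating set if it is independent (induces no edges) and dominating (every vertex outside $D$ has a neighbor in $D$); $i(G)$ is the minimum cardinality of an independent dominating set of $G$. $\alpha(G)$ is the maximum cardinality of an independent set of $G$. $H-v$ denotes $H$ with vertex $v$ deleted. For $G$ with vertex set $\{v_1,\dots,v_n\}$ and $H$ with root $v$, the rooted product $G\circ H$ is obtained from one copy of $G$ and $n$ copies $H_1,\dots,H_n$ of $H$ by identifying each $v_i$ with the copy of $v$ in $H_i$. -}

module Defs where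

open import Data.Nat using (ℕ; suc; _*_; _≤_)
open import Data.Bool using (Bool; true; false; _∧_; _∨_)
open import Data.Fin using (Fin; punchIn; remQuot)
open import Data.Fin.Properties using (_≟_)
open import Data.Fin.Subset using (Subset; _∈_; _∉_; ∣_∣)
open import Data.Product using (_×_; _,_; ∃-syntax)
open import Relation.Nullary using (¬_)
open import Relation.Nullary.Decidable using (⌊_⌋)
open import Relation.Binary.PropositionalEquality using (_≡_)

Graph : ℕ → Set
Graph n = Fin n → Fin n → Bool

record IsSimple {n : ℕ} (G : Graph n) : Set where
  field
    sym    : ∀ x y → G x y ≡ G y x
    irrefl : ∀ x → G x x ≡ false

Adj : ∀ {n} → Graph n → Fin n → Fin n → Set
Adj G x y = G x y ≡ true

Independent : ∀ {n} → Graph n → Subset n → Set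
Independent G D = ∀ x y → x ∈ D → y ∈ D → ¬ Adj G x y

Dominating : ∀ {n} → Graph n → Subset n → Set
Dominating G D = ∀ x → x ∉ D → ∃[ y ] (y ∈ D × Adj G x y)

IndependentDominating : ∀ {n} → Graph n → Subset n → Set
IndependentDominating G D = Independent G D × Dominating G D

IsIndepDomNumber : ∀ {n} → Graph n → ℕ → Set
IsIndepDomNumber G k =
  (∃[ D ] (IndependentDominating G D × ∣ D ∣ ≡ k)) ×
  (∀ D → IndependentDominating G D → k ≤ ∣ D ∣)

IsIndepNumber : ∀ {n} → Graph n → ℕ → Set
IsIndepNumber G k =
  (∃[ D ] (Independent G D × ∣ D ∣ ≡ k)) ×
  (∀ D → Independent G D → ∣ D ∣ ≤ k)

deleteVertex : ∀ {m} → Graph (suc m) → Fin (suc m) → Graph m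
deleteVertex H v x y = H (punchIn v x) (punchIn v y)

-- Rooted product G ∘ H with root v. Vertex (i , h) ∈ Fin n × Fin (suc m)
-- (encoded in Fin (n * suc m) via remQuot) is vertex h of copy H_i;
-- (i , v) is identified with vertex v_i of G.
rootedProduct : ∀ {n m} → Graph n → Graph (suc m) → Fin (suc m) → Graph (n * suc m)
rootedProduct {n} {m} G H v x y with remQuot {n} (suc m) x | remQuot {n} (suc m) y
... | i , h | j , h' =
  (⌊ i ≟ j ⌋ ∧ H h h') ∨ (⌊ h ≟ v ⌋ ∧ ⌊ h' ≟ v ⌋ ∧ G i j)

module Submission where

open import Defs
open import Data.Nat using (ℕ; zero; suc; _+_; _*_; _∸_; _≤_; _<_; z≤n; s≤s)
open import Data.Nat.Properties
  using ( ≤-trans; ≤-reflexive; _≤?_; ≰⇒>; <-≤-trans; <-irrefl; +-comm; +-suc; *-zeroʳ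
        ; +-mono-≤; +-monoʳ-≤; *-monoˡ-≤; ∸-monoˡ-≤; m≤m+n; m+[n∸m]≡n
        ; +-0-monoid; +-commutativeSemigroup; module ≤-Reasoning )
open import Data.Nat.Tactic.RingSolver using (solve-∀)
open import Algebra.Properties.CommutativeSemigroup +-commutativeSemigroup using (x∙yz≈y∙xz)
open import Algebra.Properties.Monoid.Sum +-0-monoid using (sum-syntax)
open import Data.Bool using (Bool; true; false; _∧_; _∨_; if_then_else_)
open import Data.Bool.Properties using (∨-identityʳ; ∨-zeroʳ) renaming (_≟_ to _≟ᵇ_)
open import Data.Fin using (Fin; zero; suc; punchIn; punchOut; combine)
open import Data.Fin.Properties using (_≟_; any?; punchIn-punchOut; remQuot-combine; combine-surjective)
open import Data.Fin.Subset using (Subset; inside; outside; _∈_; _∉_; _⊆_; ∣_∣; _∪_; ⁅_⁆; ∁)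
open import Data.Fin.Subset.Properties
  using ( _∈?_; drop-there; x∈p∪q⁻; x∈p∪q⁺; x∈⁅x⁆; x∈⁅y⁆⇒x≡y; ∪-identityʳ
        ; ∣p∣≤n; ∣p∣≤∣x∷p∣; ∣⁅x⁆∣≡1; ∣∁p∣≡n∸∣p∣; p⊆q⇒∣p∣≤∣q∣; p⊂q⇒∣p∣<∣q∣ )
open import Data.Vec using ([]; _∷_; here; there; _++_; concat; group; tabulate; lookup; insertAt)
open import Data.Vec.Properties
  using ( []=⇒lookup; lookup⇒[]=; lookup-concat; lookup∘tabulate; tabulate∘lookup
        ; insertAt-lookup; insertAt-punchIn )
open import Data.Vec.Functional using (Vector)
open import Data.Product using (_×_; _,_; ∃-syntax; proj₁; proj₂)
open import Data.Sum using (_⊎_; inj₁; inj₂; [_,_])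
open import Function using (_∘_; id)
open import Relation.Unary using (Decidable)
open import Relation.Nullary using (¬_; Dec; yes; no; ¬?; contradiction)
open import Relation.Nullary.Decidable using (⌊_⌋; _×-dec_; _⊎-dec_)
open import Relation.Binary.PropositionalEquality using (_≡_; _≢_; refl; sym; trans; cong; cong₂; subst)

-- Everything rests on describing a set D of vertices of G ∘ H by its fibres F i, the part
-- of D inside the copy H_i.  D is independent and dominating iff the fibres are
-- "compatible": each F i is independent and dominates H_i − v, the indices whose fibre
-- contains the root are independent in G, and a root not covered inside its own copy
-- has a G-neighbour whose fibre contains the root (RootedProduct.Compatible).
--
-- Lower bound: fibres of a minimum independent dominating set of G ∘ H that cover their
-- root are independent dominating sets of H; the others become one after adding the
-- root.  The indices C of the first kind contain the independent set of chosen roots,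
-- which dominates G outside C, so a greedy extension shows i(G) ≤ ∣ C ∣.
-- Upper bound: place a suitable fibre A (of size ≤ i(H)) over a maximum independent set
-- of G and a fibre B (of size ≤ i(H − v)) elsewhere; the existence of such a "root pair"
-- (A, B) is a case distinction on how the root relates to minimum independent dominating
-- sets of H and of H − v.

decided⁻ : ∀ {p} {P : Set p} (P? : Dec P) → ⌊ P? ⌋ ≡ true → P
decided⁻ (yes p) _ = p

decided⁺ : ∀ {p} {P : Set p} (P? : Dec P) → P → ⌊ P? ⌋ ≡ true
decided⁺ (yes _) _ = refl
decided⁺ (no ¬p) p = contradiction p ¬p

∨-true⁻ : ∀ a {b} → a ∨ b ≡ true → a ≡ true ⊎ b ≡ true
∨-true⁻ true  _ = inj₁ refl
∨-true⁻ false e = inj₂ e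

∧-true⁻ : ∀ a {b} → a ∧ b ≡ true → a ≡ true × b ≡ true
∧-true⁻ true e = refl , e

subsetOf : ∀ {n p} {P : Fin n → Set p} → Decidable P → Subset n
subsetOf P? = tabulate (λ i → ⌊ P? i ⌋)

∈subsetOf⁺ : ∀ {n p} {P : Fin n → Set p} (P? : Decidable P) {i} → P i → i ∈ subsetOf P?
∈subsetOf⁺ P? {i} Pi = lookup⇒[]= i _ (trans (lookup∘tabulate _ i) (decided⁺ (P? i) Pi))

∈subsetOf⁻ : ∀ {n p} {P : Fin n → Set p} (P? : Decidable P) {i} → i ∈ subsetOf P? → P i
∈subsetOf⁻ P? {i} i∈ = decided⁻ (P? i) (trans (sym (lookup∘tabulate _ i)) ([]=⇒lookup i∈))

∣p∣<∣p∪⁅x⁆∣ : ∀ {n} {p : Subset n} {x : Fin n} → x ∉ p → ∣ p ∣ < ∣ p ∪ ⁅ x ⁆ ∣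
∣p∣<∣p∪⁅x⁆∣ {p = p} {x} x∉p =
  p⊂q⇒∣p∣<∣q∣ ((λ y∈p → x∈p∪q⁺ (inj₁ y∈p)) , x , x∈p∪q⁺ (inj₂ (x∈⁅x⁆ x)) , x∉p)

∣p∪⁅x⁆∣≤1+∣p∣ : ∀ {n} (p : Subset n) (x : Fin n) → ∣ p ∪ ⁅ x ⁆ ∣ ≤ suc ∣ p ∣
∣p∪⁅x⁆∣≤1+∣p∣ (b ∷ p) zero rewrite ∨-zeroʳ b | ∪-identityʳ p = s≤s (∣p∣≤∣x∷p∣ b p)
∣p∪⁅x⁆∣≤1+∣p∣ (b ∷ p) (suc x) rewrite ∨-identityʳ b with b
... | true  = s≤s (∣p∪⁅x⁆∣≤1+∣p∣ p x)
... | false = ∣p∪⁅x⁆∣≤1+∣p∣ p x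

member⇒1≤∣p∣ : ∀ {m} {p : Subset m} {x : Fin m} → x ∈ p → 1 ≤ ∣ p ∣
member⇒1≤∣p∣ {p = p} {x} x∈p = subst (_≤ ∣ p ∣) (∣⁅x⁆∣≡1 x)
  (p⊆q⇒∣p∣≤∣q∣ (λ y∈ → subst (_∈ p) (sym (x∈⁅y⁆⇒x≡y x y∈)) x∈p))

Dominated : ∀ {n} → Graph n → Subset n → Fin n → Set
Dominated G S x = ∃[ y ] (y ∈ S × Adj G x y)

dominated? : ∀ {n} (G : Graph n) (S : Subset n) (x : Fin n) → Dec (Dominated G S x)
dominated? G S x = any? (λ y → (y ∈? S) ×-dec (G x y ≟ᵇ true))

Covered : ∀ {n} → Graph n → Subset n → Fin n → Set
Covered G S x = x ∈ S ⊎ Dominated G S x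

covered? : ∀ {n} (G : Graph n) (S : Subset n) (x : Fin n) → Dec (Covered G S x)
covered? G S x = (x ∈? S) ⊎-dec dominated? G S x

ids-covers : ∀ {n} {G : Graph n} {D : Subset n} → IndependentDominating G D → ∀ x → Covered G D x
ids-covers {D = D} (_ , domD) x with x ∈? D
... | yes x∈D = inj₁ x∈D
... | no x∉D = inj₂ (domD x x∉D)

ids-nonempty : ∀ {m} {H : Graph (suc m)} {D : Subset (suc m)} →
  IndependentDominating H D → 1 ≤ ∣ D ∣
ids-nonempty D-ids with ids-covers D-ids zero
... | inj₁ 0∈D = member⇒1≤∣p∣ 0∈D
... | inj₂ (_ , y∈D , _) = member⇒1≤∣p∣ y∈D

independent-∪⁅x⁆ : ∀ {n} {G : Graph n} → IsSimple G → {S : Subset n} {x : Fin n} →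
  Independent G S → ¬ Dominated G S x → Independent G (S ∪ ⁅ x ⁆)
independent-∪⁅x⁆ simple {S} {x} indS undom y z y∈ z∈ y~z
  with x∈p∪q⁻ S ⁅ x ⁆ y∈ | x∈p∪q⁻ S ⁅ x ⁆ z∈
... | inj₁ y∈S | inj₁ z∈S = indS y z y∈S z∈S y~z
... | inj₁ y∈S | inj₂ z∈x rewrite x∈⁅y⁆⇒x≡y x z∈x =
  undom (y , y∈S , trans (IsSimple.sym simple x y) y~z)
... | inj₂ y∈x | inj₁ z∈S rewrite x∈⁅y⁆⇒x≡y x y∈x = undom (z , z∈S , y~z)
... | inj₂ y∈x | inj₂ z∈x rewrite x∈⁅y⁆⇒x≡y x y∈x | x∈⁅y⁆⇒x≡y x z∈x
  with () ← trans (sym y~z) (IsSimple.irrefl simple x)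

-- A maximum independent set is dominating: an undominated outside vertex could be added.
maximum-independent-dominating : ∀ {n} {G : Graph n} → IsSimple G → ∀ {α S} →
  (∀ T → Independent G T → ∣ T ∣ ≤ α) → Independent G S → ∣ S ∣ ≡ α → Dominating G S
maximum-independent-dominating {G = G} simple {S = S} maximum indS ∣S∣≡α x x∉S
  with dominated? G S x
... | yes dom = dom
... | no undom = contradiction
  (<-≤-trans (∣p∣<∣p∪⁅x⁆∣ x∉S)
    (≤-trans (maximum _ (independent-∪⁅x⁆ simple indS undom)) (≤-reflexive (sym ∣S∣≡α))))
  (<-irrefl refl)

-- Greedy extension: an independent set S that dominates every vertex outside C ⊇ S
-- grows, by adding undominated vertices (which lie in C), to an independent dominating
-- set inside C.  The fuel k bounds the number of vertices that can still be added.
greedy-extension : ∀ {n} {G : Graph n} → IsSimple G → {C : Subset n} →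
  ∀ k S → n ≤ k + ∣ S ∣ → Independent G S → S ⊆ C → (∀ x → x ∉ C → Dominated G S x) →
  ∃[ D ] (IndependentDominating G D × D ⊆ C)
greedy-extension {n} {G} simple {C} k S fuel indS S⊆C domC
  with any? (λ x → ¬? (covered? G S x))
... | no allCovered = S , (indS , dominating) , S⊆C
  where
  dominating : Dominating G S
  dominating x x∉S with covered? G S x
  ... | yes (inj₁ x∈S) = contradiction x∈S x∉S
  ... | yes (inj₂ dom) = dom
  ... | no uncovered = contradiction (x , uncovered) allCovered
... | yes (x , uncovered) = add-x k fuel
  where
  x∉S : x ∉ S
  x∉S x∈S = uncovered (inj₁ x∈S)
  undom : ¬ Dominated G S x
  undom dom = uncovered (inj₂ dom)
  S∪x⊆C : S ∪ ⁅ x ⁆ ⊆ C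
  S∪x⊆C {y} y∈ with x∈p∪q⁻ S ⁅ x ⁆ y∈
  ... | inj₁ y∈S = S⊆C y∈S
  ... | inj₂ y∈x rewrite x∈⁅y⁆⇒x≡y x y∈x with x ∈? C
  ...   | yes x∈C = x∈C
  ...   | no x∉C = contradiction (domC x x∉C) undom
  dom′ : ∀ y → y ∉ C → Dominated G (S ∪ ⁅ x ⁆) y
  dom′ y y∉C with domC y y∉C
  ... | z , z∈S , y~z = z , x∈p∪q⁺ (inj₁ z∈S) , y~z
  -- With no fuel left, S ∪ {x} would have more than n elements.
  add-x : ∀ k → n ≤ k + ∣ S ∣ → ∃[ D ] (IndependentDominating G D × D ⊆ C)
  add-x zero fuel = contradiction (<-≤-trans (∣p∣<∣p∪⁅x⁆∣ x∉S) (≤-trans (∣p∣≤n (S ∪ ⁅ x ⁆)) fuel)) (<-irrefl refl)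
  add-x (suc k) fuel = greedy-extension simple k (S ∪ ⁅ x ⁆)
    (≤-trans fuel (≤-trans (≤-reflexive (sym (+-suc k ∣ S ∣))) (+-monoʳ-≤ k (∣p∣<∣p∪⁅x⁆∣ x∉S))))
    (independent-∪⁅x⁆ simple indS undom) S∪x⊆C dom′

ids-size-bound : ∀ {n} {G : Graph n} → IsSimple G → ∀ {iG} →
  (∀ D → IndependentDominating G D → iG ≤ ∣ D ∣) → ∀ {S C} →
  Independent G S → S ⊆ C → (∀ x → x ∉ C → Dominated G S x) → iG ≤ ∣ C ∣
ids-size-bound {n} simple minimal {S} indS S⊆C domC
  with greedy-extension simple n S (m≤m+n n ∣ S ∣) indS S⊆C domC
... | D , D-ids , D⊆C = ≤-trans (minimal D D-ids) (p⊆q⇒∣p∣≤∣q∣ D⊆C)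

-- B is an independent set of H dominating every vertex except possibly the root v,
-- i.e. independent and dominating H − v.
IndependentDominatingExcept : ∀ {m} → Graph m → Fin m → Subset m → Set
IndependentDominatingExcept H v B =
  Independent H B × (∀ h → h ≢ v → h ∉ B → Dominated H B h)

forget-root : ∀ {m} {H : Graph m} {D : Subset m} (v : Fin m) →
  IndependentDominating H D → IndependentDominatingExcept H v D
forget-root v (indD , domD) = indD , λ h _ → domD h

cover-root : ∀ {m} {H : Graph m} {v : Fin m} {B : Subset m} →
  IndependentDominatingExcept H v B → Covered H B v → IndependentDominating H B
cover-root {v = v} (indB , domB) covered = indB , dom
  where
  dom : Dominating _ _
  dom h h∉B with h ≟ v
  ... | no h≢v = domB h h≢v h∉B
  ... | yes refl = [ (λ v∈B → contradiction v∈B h∉B) , id ] covered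

add-root : ∀ {m} {H : Graph m} → IsSimple H → {v : Fin m} {B : Subset m} →
  IndependentDominatingExcept H v B → ¬ Covered H B v → IndependentDominating H (B ∪ ⁅ v ⁆)
add-root simple {v} {B} (indB , domB) uncovered =
  independent-∪⁅x⁆ simple indB (λ domv → uncovered (inj₂ domv)) , dom
  where
  dom : Dominating _ _
  dom h h∉ with h ≟ v
  ... | yes refl = contradiction (x∈p∪q⁺ (inj₂ (x∈⁅x⁆ v))) h∉
  ... | no h≢v with domB h h≢v (λ h∈B → h∉ (x∈p∪q⁺ (inj₁ h∈B)))
  ...   | h′ , h′∈B , h~h′ = h′ , x∈p∪q⁺ (inj₁ h′∈B) , h~h′

covered-size : ∀ {m} {H : Graph (suc m)} {v : Fin (suc m)} {iH} → IsIndepDomNumber H iH →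
  ∀ {B} → IndependentDominatingExcept H v B → Covered H B v → suc (iH ∸ 1) ≤ ∣ B ∣
covered-size ((A , A-ids , ∣A∣≡iH) , minimal) {B} B-ids covered = subst (_≤ ∣ B ∣)
  (sym (m+[n∸m]≡n (subst (1 ≤_) ∣A∣≡iH (ids-nonempty A-ids))))
  (minimal B (cover-root B-ids covered))

uncovered-size : ∀ {m} {H : Graph m} {v : Fin m} → IsSimple H → ∀ {iH} →
  (∀ D → IndependentDominating H D → iH ≤ ∣ D ∣) →
  ∀ {B} → IndependentDominatingExcept H v B → ¬ Covered H B v → iH ∸ 1 ≤ ∣ B ∣
uncovered-size {v = v} simple minimal {B} B-ids uncovered =
  ∸-monoˡ-≤ 1 (≤-trans (minimal _ (add-root simple B-ids uncovered)) (∣p∪⁅x⁆∣≤1+∣p∣ B v))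

data Punched {m} (v : Fin (suc m)) : Fin (suc m) → Set where
  isRoot : Punched v v
  image  : ∀ x → Punched v (punchIn v x)

punched : ∀ {m} (v h : Fin (suc m)) → Punched v h
punched v h with v ≟ h
... | yes refl = isRoot
... | no v≢h = subst (Punched v) (punchIn-punchOut v≢h) (image (punchOut v≢h))

liftSubset : ∀ {m} → Fin (suc m) → Subset m → Subset (suc m)
liftSubset v D = insertAt D v outside

root∉liftSubset : ∀ {m} (v : Fin (suc m)) (D : Subset m) → v ∉ liftSubset v D
root∉liftSubset v D v∈ with () ← trans (sym ([]=⇒lookup v∈)) (insertAt-lookup D v outside)

∈liftSubset⁺ : ∀ {m} (v : Fin (suc m)) {D : Subset m} {x} → x ∈ D → punchIn v x ∈ liftSubset v D
∈liftSubset⁺ v {D} {x} x∈D = lookup⇒[]= _ _ (trans (insertAt-punchIn D v outside x) ([]=⇒lookup x∈D))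

∈liftSubset⁻ : ∀ {m} (v : Fin (suc m)) {D : Subset m} {x} → punchIn v x ∈ liftSubset v D → x ∈ D
∈liftSubset⁻ v {D} {x} x∈ = lookup⇒[]= _ _ (trans (sym (insertAt-punchIn D v outside x)) ([]=⇒lookup x∈))

∣liftSubset∣ : ∀ {m} (v : Fin (suc m)) (D : Subset m) → ∣ liftSubset v D ∣ ≡ ∣ D ∣
∣liftSubset∣ zero D = refl
∣liftSubset∣ (suc v) (outside ∷ D) = ∣liftSubset∣ v D
∣liftSubset∣ (suc v) (inside ∷ D) = cong suc (∣liftSubset∣ v D)

lift-deletion : ∀ {m} {H : Graph (suc m)} (v : Fin (suc m)) {D : Subset m} →
  IndependentDominating (deleteVertex H v) D → IndependentDominatingExcept H v (liftSubset v D)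
lift-deletion {H = H} v {D} (indD , domD) = ind , dom
  where
  ind : Independent H (liftSubset v D)
  ind h h′ h∈ h′∈ with punched v h | punched v h′
  ... | isRoot | _ = λ _ → root∉liftSubset v D h∈
  ... | image _ | isRoot = λ _ → root∉liftSubset v D h′∈
  ... | image x | image x′ = indD x x′ (∈liftSubset⁻ v h∈) (∈liftSubset⁻ v h′∈)
  dom : ∀ h → h ≢ v → h ∉ liftSubset v D → Dominated H (liftSubset v D) h
  dom h h≢v h∉ with punched v h
  ... | isRoot = contradiction refl h≢v
  ... | image x with domD x (λ x∈D → h∉ (∈liftSubset⁺ v x∈D))
  ...   | y , y∈D , x~y = punchIn v y , ∈liftSubset⁺ v y∈D , x~y

-- Two fibres for building an independent dominating set of a rooted product: A is placed
-- on the copies over a maximum independent set of G, B on all other copies.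
record RootPair {m} (H : Graph (suc m)) (v : Fin (suc m)) (a b : ℕ) : Set where
  field
    A B    : Subset (suc m)
    A-ids  : IndependentDominating H A
    B-ids  : IndependentDominatingExcept H v B
    v∉B    : v ∉ B
    A∨B-covers-root : v ∈ A ⊎ Dominated H B v
    ∣A∣≤a  : ∣ A ∣ ≤ a
    ∣B∣≤b  : ∣ B ∣ ≤ b

-- Such fibres exist as soon as H has an independent dominating set A of size at most a
-- and some L avoiding the root, independent and dominating H − v, has size at most b:
-- take (A, L) if A contains or L dominates the root; otherwise (A, A) if a ≤ b and
-- (L ∪ {v}, L) if a > b.
root-pair : ∀ {m} {H : Graph (suc m)} {v : Fin (suc m)} → IsSimple H → ∀ {a b A L} →
  IndependentDominating H A → ∣ A ∣ ≤ a →
  IndependentDominatingExcept H v L → v ∉ L → ∣ L ∣ ≤ b → RootPair H v a b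
root-pair {H = H} {v} simple {a} {b} {A} {L} A-ids ∣A∣≤a L-ids v∉L ∣L∣≤b
  with v ∈? A | dominated? H L v
... | yes v∈A | _ = record { A = A ; B = L ; A-ids = A-ids ; B-ids = L-ids ; v∉B = v∉L
  ; A∨B-covers-root = inj₁ v∈A ; ∣A∣≤a = ∣A∣≤a ; ∣B∣≤b = ∣L∣≤b }
... | no _ | yes L-dominates-v = record { A = A ; B = L ; A-ids = A-ids ; B-ids = L-ids ; v∉B = v∉L
  ; A∨B-covers-root = inj₂ L-dominates-v ; ∣A∣≤a = ∣A∣≤a ; ∣B∣≤b = ∣L∣≤b }
... | no v∉A | no L-misses-v with a ≤? b
...   | yes a≤b = record { A = A ; B = A ; A-ids = A-ids
  ; B-ids = forget-root v A-ids ; v∉B = v∉A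
  ; A∨B-covers-root = inj₂ (proj₂ A-ids v v∉A) ; ∣A∣≤a = ∣A∣≤a ; ∣B∣≤b = ≤-trans ∣A∣≤a a≤b }
...   | no a≰b = record { A = L ∪ ⁅ v ⁆ ; B = L
  ; A-ids = add-root simple L-ids [ v∉L , L-misses-v ] ; B-ids = L-ids ; v∉B = v∉L
  ; A∨B-covers-root = inj₁ (x∈p∪q⁺ (inj₂ (x∈⁅x⁆ v)))
  ; ∣A∣≤a = ≤-trans (∣p∪⁅x⁆∣≤1+∣p∣ L v) (≤-trans (s≤s ∣L∣≤b) (≰⇒> a≰b)) ; ∣B∣≤b = ∣L∣≤b }

∣p++q∣ : ∀ {a b} (p : Subset a) (q : Subset b) → ∣ p ++ q ∣ ≡ ∣ p ∣ + ∣ q ∣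
∣p++q∣ [] q = refl
∣p++q∣ (outside ∷ p) q = ∣p++q∣ p q
∣p++q∣ (inside ∷ p) q = cong suc (∣p++q∣ p q)

glue : ∀ {n k} → (Fin n → Subset k) → Subset (n * k)
glue F = concat (tabulate F)

∣glue∣ : ∀ {n k} (F : Fin n → Subset k) → ∣ glue F ∣ ≡ ∑[ i < n ] ∣ F i ∣
∣glue∣ {zero} F = refl
∣glue∣ {suc n} F = trans (∣p++q∣ (F zero) (glue (F ∘ suc))) (cong (∣ F zero ∣ +_) (∣glue∣ (F ∘ suc)))

lookup-glue : ∀ {n k} (F : Fin n → Subset k) i h → lookup (glue F) (combine i h) ≡ lookup (F i) h
lookup-glue F i h = trans (lookup-concat (tabulate F) i h) (cong (λ p → lookup p h) (lookup∘tabulate F i))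

∈glue⁺ : ∀ {n k} (F : Fin n → Subset k) {i h} → h ∈ F i → combine i h ∈ glue F
∈glue⁺ F {i} {h} h∈ = lookup⇒[]= _ _ (trans (lookup-glue F i h) ([]=⇒lookup h∈))

∈glue⁻ : ∀ {n k} (F : Fin n → Subset k) {i h} → combine i h ∈ glue F → h ∈ F i
∈glue⁻ F {i} {h} ih∈ = lookup⇒[]= _ _ (trans (sym (lookup-glue F i h)) ([]=⇒lookup ih∈))

glue-surjective : ∀ {n k} (D : Subset (n * k)) → ∃[ F ] (D ≡ glue F)
glue-surjective {n} {k} D with group n k D
... | blocks , D≡ = lookup blocks , trans D≡ (cong concat (sym (tabulate∘lookup blocks)))

∑-lower-bound : ∀ {n} (C : Subset n) (x : Vector ℕ n) (c : ℕ) →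
  (∀ i → i ∈ C → suc c ≤ x i) → (∀ i → i ∉ C → c ≤ x i) → ∣ C ∣ + n * c ≤ ∑[ i < n ] x i
∑-lower-bound [] x c _ _ = z≤n
∑-lower-bound {suc n} (inside ∷ C) x c big small = begin
  suc ∣ C ∣ + (c + n * c) ≡⟨ cong suc (x∙yz≈y∙xz ∣ C ∣ c (n * c)) ⟩
  suc c + (∣ C ∣ + n * c) ≤⟨ +-mono-≤ (big zero here) (∑-lower-bound C (x ∘ suc) c
                               (λ i → big (suc i) ∘ there) (λ i i∉C → small (suc i) (i∉C ∘ drop-there))) ⟩
  ∑[ i < suc n ] x i      ∎
  where open ≤-Reasoning
∑-lower-bound {suc n} (outside ∷ C) x c big small = begin
  ∣ C ∣ + (c + n * c)     ≡⟨ x∙yz≈y∙xz ∣ C ∣ c (n * c) ⟩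
  c + (∣ C ∣ + n * c)     ≤⟨ +-mono-≤ (small zero λ ()) (∑-lower-bound C (x ∘ suc) c
                               (λ i → big (suc i) ∘ there) (λ i i∉C → small (suc i) (i∉C ∘ drop-there))) ⟩
  ∑[ i < suc n ] x i      ∎
  where open ≤-Reasoning

∑-select : ∀ {n k} (S : Subset n) (A B : Subset k) →
  ∑[ i < n ] ∣ (if lookup S i then A else B) ∣ ≡ ∣ A ∣ * ∣ S ∣ + ∣ B ∣ * ∣ ∁ S ∣
∑-select [] A B = sym (cong₂ _+_ (*-zeroʳ ∣ A ∣) (*-zeroʳ ∣ B ∣))
∑-select (inside ∷ S) A B = trans (cong (∣ A ∣ +_) (∑-select S A B)) (count-A (∣ A ∣) (∣ B ∣) (∣ S ∣) (∣ ∁ S ∣))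
  where
  count-A : ∀ a b s t → a + (a * s + b * t) ≡ a * suc s + b * t
  count-A = solve-∀
∑-select (outside ∷ S) A B = trans (cong (∣ B ∣ +_) (∑-select S A B)) (count-B (∣ A ∣) (∣ B ∣) (∣ S ∣) (∣ ∁ S ∣))
  where
  count-B : ∀ a b s t → b + (a * s + b * t) ≡ a * s + b * suc t
  count-B = solve-∀

module RootedProduct {n m} (G : Graph n) (H : Graph (suc m)) (v : Fin (suc m)) where

  GH : Graph (n * suc m)
  GH = rootedProduct G H v

  adjacency : ∀ i h j h′ → GH (combine i h) (combine j h′) ≡
    (⌊ i ≟ j ⌋ ∧ H h h′) ∨ (⌊ h ≟ v ⌋ ∧ ⌊ h′ ≟ v ⌋ ∧ G i j)
  adjacency i h j h′ = cong₂ edge (remQuot-combine i h) (remQuot-combine j h′)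
    where
    edge : Fin n × Fin (suc m) → Fin n × Fin (suc m) → Bool
    edge (i , h) (j , h′) = (⌊ i ≟ j ⌋ ∧ H h h′) ∨ (⌊ h ≟ v ⌋ ∧ ⌊ h′ ≟ v ⌋ ∧ G i j)

  adj-fibre : ∀ i {h h′} → Adj H h h′ → Adj GH (combine i h) (combine i h′)
  adj-fibre i {h} {h′} h~h′ rewrite adjacency i h i h′ | decided⁺ (i ≟ i) refl | h~h′ = refl

  adj-roots : ∀ {i j} → Adj G i j → Adj GH (combine i v) (combine j v)
  adj-roots {i} {j} i~j rewrite adjacency i v j v | decided⁺ (v ≟ v) refl | i~j = ∨-zeroʳ _

  adj-cases : ∀ i h j h′ → Adj GH (combine i h) (combine j h′) →
    (i ≡ j × Adj H h h′) ⊎ (h ≡ v × h′ ≡ v × Adj G i j)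
  adj-cases i h j h′ adj with ∨-true⁻ (⌊ i ≟ j ⌋ ∧ H h h′) (trans (sym (adjacency i h j h′)) adj)
  ... | inj₁ same with ∧-true⁻ ⌊ i ≟ j ⌋ same
  ...   | i≡j , h~h′ = inj₁ (decided⁻ (i ≟ j) i≡j , h~h′)
  adj-cases i h j h′ adj | inj₂ roots with ∧-true⁻ ⌊ h ≟ v ⌋ roots
  ...   | h≡v , rest with ∧-true⁻ ⌊ h′ ≟ v ⌋ rest
  ...     | h′≡v , i~j = inj₂ (decided⁻ (h ≟ v) h≡v , decided⁻ (h′ ≟ v) h′≡v , i~j)

  -- Conditions on the fibres F i = D ∩ V(H_i) characterising independent dominating
  -- sets D of G ∘ H: each fibre handles its copy of H − v, the chosen roots are
  -- independent in G, and an uncovered root is dominated through G by a chosen root.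
  record Compatible (F : Fin n → Subset (suc m)) : Set where
    field
      fibre        : ∀ i → IndependentDominatingExcept H v (F i)
      roots-indep  : ∀ i j → v ∈ F i → v ∈ F j → ¬ Adj G i j
      roots-dom    : ∀ i → ¬ Covered H (F i) v → ∃[ j ] (v ∈ F j × Adj G i j)

  compatible⇒ids : ∀ {F} → Compatible F → IndependentDominating GH (glue F)
  compatible⇒ids {F} compatible = ind , dom
    where
    open Compatible compatible
    ind : Independent GH (glue F)
    ind x y x∈ y∈ adj with combine-surjective {n} {suc m} x | combine-surjective {n} {suc m} y
    ... | i , h , refl | j , h′ , refl with adj-cases i h j h′ adj
    ...   | inj₁ (refl , h~h′) = proj₁ (fibre i) h h′ (∈glue⁻ F x∈) (∈glue⁻ F y∈) h~h′
    ...   | inj₂ (refl , refl , i~j) = roots-indep i j (∈glue⁻ F x∈) (∈glue⁻ F y∈) i~j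
    dom : Dominating GH (glue F)
    dom x x∉ with combine-surjective {n} {suc m} x
    ... | i , h , refl with h ≟ v
    ...   | no h≢v with proj₂ (fibre i) h h≢v (x∉ ∘ ∈glue⁺ F)
    ...     | h′ , h′∈ , h~h′ = combine i h′ , ∈glue⁺ F h′∈ , adj-fibre i h~h′
    dom x x∉ | i , h , refl | yes refl with covered? H (F i) v
    ...     | yes (inj₁ v∈) = contradiction (∈glue⁺ F v∈) x∉
    ...     | yes (inj₂ (h′ , h′∈ , v~h′)) = combine i h′ , ∈glue⁺ F h′∈ , adj-fibre i v~h′
    ...     | no uncovered with roots-dom i uncovered
    ...       | j , v∈ , i~j = combine j v , ∈glue⁺ F v∈ , adj-roots i~j

  ids⇒compatible : ∀ {F} → IndependentDominating GH (glue F) → Compatible F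
  ids⇒compatible {F} (indD , domD) = record
    { fibre = λ i → (λ h h′ h∈ h′∈ → indD _ _ (∈glue⁺ F h∈) (∈glue⁺ F h′∈) ∘ adj-fibre i) , fibre-dom i
    ; roots-indep = λ i j v∈ v∈′ → indD _ _ (∈glue⁺ F v∈) (∈glue⁺ F v∈′) ∘ adj-roots
    ; roots-dom = roots-dom
    }
    where
    fibre-dom : ∀ i h → h ≢ v → h ∉ F i → Dominated H (F i) h
    fibre-dom i h h≢v h∉ with domD (combine i h) (h∉ ∘ ∈glue⁻ F)
    ... | y , y∈ , adj with combine-surjective {n} {suc m} y
    ...   | j , h′ , refl with adj-cases i h j h′ adj
    ...     | inj₁ (refl , h~h′) = h′ , ∈glue⁻ F y∈ , h~h′
    ...     | inj₂ (h≡v , _) = contradiction h≡v h≢v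
    roots-dom : ∀ i → ¬ Covered H (F i) v → ∃[ j ] (v ∈ F j × Adj G i j)
    roots-dom i uncovered with domD (combine i v) (λ v∈ → uncovered (inj₁ (∈glue⁻ F v∈)))
    ... | y , y∈ , adj with combine-surjective {n} {suc m} y
    ...   | j , h′ , refl with adj-cases i v j h′ adj
    ...     | inj₁ (refl , v~h′) = contradiction (inj₂ (h′ , ∈glue⁻ F y∈ , v~h′)) uncovered
    ...     | inj₂ (_ , refl , i~j) = j , ∈glue⁻ F y∈ , i~j

  select-compatible : ∀ {a b} {S : Subset n} → Independent G S → Dominating G S →
    (P : RootPair H v a b) → Compatible (λ i → if lookup S i then RootPair.A P else RootPair.B P)
  select-compatible {S = S} S-indep S-dom P = record
    { fibre = fibre ; roots-indep = roots-indep ; roots-dom = roots-dom }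
    where
    open RootPair P
    F : Fin n → Subset (suc m)
    F i = if lookup S i then A else B
    fibre : ∀ i → IndependentDominatingExcept H v (F i)
    fibre i with lookup S i
    ... | true  = forget-root v A-ids
    ... | false = B-ids
    root⇒∈S : ∀ i → v ∈ F i → i ∈ S
    root⇒∈S i v∈ with lookup S i in eq
    ... | true  = lookup⇒[]= i S eq
    ... | false = contradiction v∈ v∉B
    roots-indep : ∀ i j → v ∈ F i → v ∈ F j → ¬ Adj G i j
    roots-indep i j v∈i v∈j = S-indep i j (root⇒∈S i v∈i) (root⇒∈S j v∈j)
    A-over-S : ∀ {j} → j ∈ S → v ∈ A → v ∈ F j
    A-over-S j∈S v∈A rewrite []=⇒lookup j∈S = v∈A
    roots-dom : ∀ i → ¬ Covered H (F i) v → ∃[ j ] (v ∈ F j × Adj G i j)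
    roots-dom i uncovered with lookup S i in eq
    ... | true  = contradiction (ids-covers A-ids v) uncovered
    ... | false with A∨B-covers-root
    ...   | inj₂ B-dominates-v = contradiction (inj₂ B-dominates-v) uncovered
    ...   | inj₁ v∈A with S-dom i (λ i∈S → contradiction (trans (sym ([]=⇒lookup i∈S)) eq) λ ())
    ...     | j , j∈S , i~j = j , A-over-S j∈S v∈A , i~j

  -- Cut a minimum independent dominating set of G ∘ H into fibres.  A fibre
  -- covering its root is an independent dominating set of H, one not covering it becomes
  -- one after adding the root; so fibres over the set C of covered roots have at least
  -- i(H) elements and the others at least i(H) − 1.  The copies whose root is chosen form
  -- an independent set R ⊆ C of G dominating every vertex outside C, so i(G) ≤ ∣ C ∣.
  lower-bound : IsSimple G → IsSimple H → ∀ {iG iH iGH} →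
    IsIndepDomNumber G iG → IsIndepDomNumber H iH → IsIndepDomNumber GH iGH →
    n * (iH ∸ 1) + iG ≤ iGH
  lower-bound simpleG simpleH {iG} {iH} {iGH} (_ , minimalG) iH-spec ((D , D-ids , ∣D∣≡iGH) , _)
    with glue-surjective {n} {suc m} D
  ... | F , refl = begin
    n * (iH ∸ 1) + iG    ≤⟨ +-monoʳ-≤ (n * (iH ∸ 1)) (ids-size-bound simpleG minimalG R-indep R⊆C R-dom) ⟩
    n * (iH ∸ 1) + ∣ C ∣ ≡⟨ +-comm (n * (iH ∸ 1)) ∣ C ∣ ⟩
    ∣ C ∣ + n * (iH ∸ 1) ≤⟨ ∑-lower-bound C (∣_∣ ∘ F) (iH ∸ 1) covered-fibre uncovered-fibre ⟩
    ∑[ i < n ] ∣ F i ∣   ≡⟨ sym (∣glue∣ F) ⟩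
    ∣ glue F ∣           ≡⟨ ∣D∣≡iGH ⟩
    iGH                  ∎
    where
    open ≤-Reasoning
    open Compatible (ids⇒compatible D-ids)
    C R : Subset n
    C = subsetOf (λ i → covered? H (F i) v)
    R = subsetOf (λ i → v ∈? F i)
    covered-fibre : ∀ i → i ∈ C → suc (iH ∸ 1) ≤ ∣ F i ∣
    covered-fibre i i∈C = covered-size iH-spec (fibre i) (∈subsetOf⁻ _ i∈C)
    uncovered-fibre : ∀ i → i ∉ C → iH ∸ 1 ≤ ∣ F i ∣
    uncovered-fibre i i∉C = uncovered-size simpleH (proj₂ iH-spec) (fibre i) (i∉C ∘ ∈subsetOf⁺ _)
    R-indep : Independent G R
    R-indep i j i∈R j∈R = roots-indep i j (∈subsetOf⁻ _ i∈R) (∈subsetOf⁻ _ j∈R)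
    R⊆C : R ⊆ C
    R⊆C i∈R = ∈subsetOf⁺ _ (inj₁ (∈subsetOf⁻ _ i∈R))
    R-dom : ∀ i → i ∉ C → Dominated G R i
    R-dom i i∉C with roots-dom i (i∉C ∘ ∈subsetOf⁺ _)
    ... | j , v∈ , i~j = j , ∈subsetOf⁺ _ v∈ , i~j

  -- Upper bound.  Put the fibre A of a root pair of sizes (i(H), i(H − v)) over a maximum
  -- independent set S of G — which dominates G — and the fibre B everywhere else.
  upper-bound : IsSimple G → IsSimple H → ∀ {iH iHv αG iGH} →
    IsIndepDomNumber H iH → IsIndepDomNumber (deleteVertex H v) iHv →
    IsIndepNumber G αG → IsIndepDomNumber GH iGH →
    iGH ≤ iH * αG + iHv * (n ∸ αG)
  upper-bound simpleG simpleH {iH} {iHv} {αG} {iGH} ((Hmin , Hmin-ids , ∣Hmin∣≡iH) , _)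
    ((D , D-ids , ∣D∣≡iHv) , _) ((S , S-indep , ∣S∣≡αG) , maximumG) (_ , minimalGH) = begin
    iGH                                  ≤⟨ minimalGH (glue F) (compatible⇒ids compatible) ⟩
    ∣ glue F ∣                           ≡⟨ ∣glue∣ F ⟩
    ∑[ i < n ] ∣ F i ∣                   ≡⟨ ∑-select S A B ⟩
    ∣ A ∣ * ∣ S ∣ + ∣ B ∣ * ∣ ∁ S ∣      ≡⟨ cong₂ (λ s t → ∣ A ∣ * s + ∣ B ∣ * t) ∣S∣≡αG
                                              (trans (∣∁p∣≡n∸∣p∣ S) (cong (n ∸_) ∣S∣≡αG)) ⟩
    ∣ A ∣ * αG + ∣ B ∣ * (n ∸ αG)        ≤⟨ +-mono-≤ (*-monoˡ-≤ αG ∣A∣≤a) (*-monoˡ-≤ (n ∸ αG) ∣B∣≤b) ⟩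
    iH * αG + iHv * (n ∸ αG)             ∎
    where
    open ≤-Reasoning
    pair : RootPair H v iH iHv
    pair = root-pair simpleH Hmin-ids (≤-reflexive ∣Hmin∣≡iH) (lift-deletion v D-ids)
      (root∉liftSubset v D) (≤-reflexive (trans (∣liftSubset∣ v D) ∣D∣≡iHv))
    open RootPair pair
    F : Fin n → Subset (suc m)
    F i = if lookup S i then A else B
    compatible : Compatible F
    compatible = select-compatible S-indep
      (maximum-independent-dominating simpleG maximumG S-indep ∣S∣≡αG) pair

-- The theorem; the bounds hold without the order assumptions n ≥ 2 and m ≥ 1.
mainTheorem6 : ∀ {n m} (G : Graph n) (H : Graph (suc m)) (v : Fin (suc m)) →
    2 ≤ n → 1 ≤ m → IsSimple G → IsSimple H →
    ∀ (iG iH iHv αG iGH : ℕ) →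
    IsIndepDomNumber G iG → IsIndepDomNumber H iH →
    IsIndepDomNumber (deleteVertex H v) iHv → IsIndepNumber G αG →
    IsIndepDomNumber (rootedProduct G H v) iGH →
    (n * (iH ∸ 1) + iG ≤ iGH) × (iGH ≤ iH * αG + iHv * (n ∸ αG))
mainTheorem6 G H v _ _ simpleG simpleH _ _ _ _ _ iG-spec iH-spec iHv-spec αG-spec iGH-spec =
  lower-bound simpleG simpleH iG-spec iH-spec iGH-spec ,
  upper-bound simpleG simpleH iH-spec iHv-spec αG-spec iGH-spec
  where open RootedProduct G H v
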